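{- Let $n\ge 3$ and let $P(G(n))$ be the power graph of the gyrogroup $(G(n),\oplus)$ described in the context, with identity $e=0$. Then: (1) the detour eccentricity is $ec_D(u)=2^{n-1}$ if $u\in P(n)\setminus\{e\}$, $ec_D(e)=2^{n-1}-1$, and $ec_D(u)=2^{n-1}$ if $u\in H(n)$; (2) the detour radius is $rad_D(P(G(n)))=2^{n-1}-1$; (3) the detour diameter is $dia_D(P(G(n)))=2^{n-1}$.
   Context: Let $n\ge 3$ and $m=2^{n-1}$. Put $P(n)=\{0,1,\dots,m-1\}$, $H(n)=\{m,m+1,\dots,2^n-1\}$ and $G(n)=P(n)\cup H(n)$. Define a binary operation $\oplus$ on $G(n)$ by: $i\oplus j=t$ if $(i,j)\in P(n)\times P(n)$; $i\oplus j=t+m$ if $(i,j)\in P(n)\times H(n)$; $i\oplus j=s+m$ if $(i,j)\in H(n)\times P(n)$; $i\oplus j=k$ if $(i,j)\in H(n)\times H(n)$, where $t,s,k\in P(n)$ are determined by $t\equiv i+j$, $s\equiv i+(\tfrac m2-1)j$, $k\equiv(\tfrac m2+1)i+(\tfrac m2-1)j \pmod m$. Then $(G(n),\oplus)$ is a gyrogroup with identity $e=0$. Powers are defined by $a^1=a$, $a^{k+1}=a\oplus a^k$. The power graph $P(G(n))$ is the simple undirected graph with vertex set $G(n)$ in which two distinct vertices $u,v$ are adjacent if and only if $u^k=v$ or $v^k=u$ for some positive integer $k$. In a connected graph, the detour distance $d_D(u,v)$ is the length of a longest $u$–$v$ path; the detour eccentricity $ec_D(u)$ is $\max_v d_D(u,v)$;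 the detour radius and detour diameter are the minimum and maximum detour eccentricity over all vertices. -}

module Defs where

open import Data.Nat using (ℕ; zero; suc; _+_; _*_; _∸_; _^_; _≤_; _<_; _<?_)
open import Data.Nat.DivMod using (_%_)
open import Data.Nat.Properties using (m^n≢0)
open import Data.Fin using (Fin; fromℕ; inject₁) renaming (zero to fzero; suc to fsuc)
open import Data.Product using (Σ; _×_; _,_)
open import Data.Sum using (_⊎_)
open import Relation.Nullary using (¬_; yes; no)
open import Relation.Binary.PropositionalEquality using (_≡_; _≢_)
open import Function.Definitions using (Injective)

-- m = 2^(n-1): the P(n) part is {0,…,m-1}, H(n) = {m,…,2^n-1}
half : ℕ → ℕ
half n = 2 ^ (n ∸ 1)

quarter : ℕ → ℕ
quarter n = 2 ^ (n ∸ 2)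

modm : ℕ → ℕ → ℕ
modm n x = _%_ x (2 ^ (n ∸ 1)) {{m^n≢0 2 (n ∸ 1)}}

op : ℕ → ℕ → ℕ → ℕ
op n i j with i <? half n | j <? half n
... | yes _ | yes _ = modm n (i + j)
... | yes _ | no  _ = modm n (i + j) + half n
... | no  _ | yes _ = modm n (i + (quarter n ∸ 1) * j) + half n
... | no  _ | no  _ = modm n ((quarter n + 1) * i + (quarter n ∸ 1) * j)

-- pow n a k = a^(k+1), with a^1 = a and a^(k+1) = a ⊕ a^k
pow : ℕ → ℕ → ℕ → ℕ
pow n a zero    = a
pow n a (suc k) = op n a (pow n a k)

InG : ℕ → ℕ → Set
InG n x = x < 2 ^ n

Adj : ℕ → ℕ → ℕ → Set
Adj n u v = u ≢ v × (Σ ℕ λ k → pow n u k ≡ v ⊎ pow n v k ≡ u)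

record Path (n u v L : ℕ) : Set where
  field
    vert     : Fin (suc L) → ℕ
    inG      : ∀ i → InG n (vert i)
    start    : vert fzero ≡ u
    end      : vert (fromℕ L) ≡ v
    distinct : Injective _≡_ _≡_ vert
    adjacent : ∀ (i : Fin L) → Adj n (vert (inject₁ i)) (vert (fsuc i))

IsDetourDist : ℕ → ℕ → ℕ → ℕ → Set
IsDetourDist n u v d = Path n u v d × (∀ L → Path n u v L → L ≤ d)

IsDetourEcc : ℕ → ℕ → ℕ → Set
IsDetourEcc n u e =
  (∀ v → InG n v → Σ ℕ λ d → IsDetourDist n u v d × d ≤ e)
  × (Σ ℕ λ v → InG n v × IsDetourDist n u v e)

IsDetourRadius : ℕ → ℕ → Set
IsDetourRadius n r =
  (Σ ℕ λ u → InG n u × IsDetourEcc n u r)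
  × (∀ u e → InG n u → IsDetourEcc n u e → r ≤ e)

IsDetourDiameter : ℕ → ℕ → Set
IsDetourDiameter n D =
  (Σ ℕ λ u → InG n u × IsDetourEcc n u D)
  × (∀ u e → InG n u → IsDetourEcc n u e → e ≤ D)

-- The elements of P(n) form the cyclic group ℤ/m with m = 2^(n-1), and the cyclic subgroups of a
-- cyclic 2-group form a chain, so P(n) is a clique of the power graph. Every h ∈ H(n) satisfies
-- h ⊕ h = 0 and h ⊕ 0 = h, and no power of another element equals h, so h is a pendant vertex
-- attached to e = 0. In a clique on m vertices with pendants hanging from one of them, every interior
-- vertex of a path lies in the clique. Hence the longest paths have length m − 1 inside the clique
-- (a Hamiltonian path), m from a pendant to a clique vertex other than e, 1 from a pendant to e and
-- 2 between two pendants; the eccentricities, the radius and the diameter are read off from these.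
module Submission where

open import Defs
open import Data.Nat hiding (parity)
open import Data.Nat.Properties
open import Data.Nat.DivMod
open import Data.Nat.Divisibility
open import Data.Nat.GCD
open import Data.Nat.Tactic.RingSolver using (solve-∀)
open import Data.Fin using (Fin; toℕ; fromℕ; fromℕ<; inject₁) renaming (zero to fzero; suc to fsuc)
open import Data.Fin.Properties
  using (toℕ<n; toℕ-injective; toℕ-fromℕ; toℕ-fromℕ<; fromℕ<-toℕ; toℕ-inject₁; injective⇒≤)
open import Data.Product using (∃-syntax; _×_; _,_)
open import Data.Sum using (_⊎_; inj₁; inj₂)
open import Relation.Nullary using (Dec; yes; no; contradiction)
open import Relation.Binary.Definitions using (Symmetric)
open import Relation.Binary.PropositionalEquality

data Parity : ℕ → Set where
  even : ∀ k → Parity (2 * k)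
  odd  : ∀ k → Parity (1 + 2 * k)

parity : ∀ n → Parity n
parity zero    = even 0
parity (suc n) with parity n
... | even k = odd k
... | odd  k = subst Parity (cong suc (+-suc k (k + 0))) (even (suc k))

odd∣2*n⇒odd∣n : ∀ k n → 1 + 2 * k ∣ 2 * n → 1 + 2 * k ∣ n
odd∣2*n⇒odd∣n k n (divides q 2n≡q*o) with parity q
... | even j = divides j (*-cancelˡ-≡ n (j * (1 + 2 * k)) 2
                 (trans 2n≡q*o (*-assoc 2 j (1 + 2 * k))))
... | odd  j = contradiction (trans 2n≡q*o (odd*odd j k)) (even≢odd n (j + k + 2 * j * k))
  where
  odd*odd : ∀ j k → (1 + 2 * j) * (1 + 2 * k) ≡ 1 + 2 * (j + k + 2 * j * k)
  odd*odd = solve-∀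

∣2^n⇒≡2^ : ∀ n {d} → d ∣ 2 ^ n → ∃[ j ] d ≡ 2 ^ j
∣2^n⇒≡2^ zero    d∣1 = 0 , ∣1⇒≡1 d∣1
∣2^n⇒≡2^ (suc n) {d} d∣2^n with parity d
... | even k with ∣2^n⇒≡2^ n (*-cancelˡ-∣ {k} {2 ^ n} 2 d∣2^n)
...   | j , k≡2^j = suc j , cong (2 *_) k≡2^j
∣2^n⇒≡2^ (suc n) {d} d∣2^n | odd k = ∣2^n⇒≡2^ n (odd∣2*n⇒odd∣n k (2 ^ n) d∣2^n)

2^-∣-mono : ∀ {i j} → i ≤ j → 2 ^ i ∣ 2 ^ j
2^-∣-mono {i} {j} i≤j = divides (2 ^ (j ∸ i)) (begin
  2 ^ j             ≡⟨ cong (2 ^_) (m∸n+n≡m i≤j) ⟨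
  2 ^ (j ∸ i + i)   ≡⟨ ^-distribˡ-+-* 2 (j ∸ i) i ⟩
  2 ^ (j ∸ i) * 2 ^ i ∎)
  where open ≡-Reasoning

∣2^n-total : ∀ n {d e} → d ∣ 2 ^ n → e ∣ 2 ^ n → d ∣ e ⊎ e ∣ d
∣2^n-total n d∣2^n e∣2^n with ∣2^n⇒≡2^ n d∣2^n | ∣2^n⇒≡2^ n e∣2^n
... | i , refl | j , refl with ≤-total i j
...   | inj₁ i≤j = inj₁ (2^-∣-mono i≤j)
...   | inj₂ j≤i = inj₂ (2^-∣-mono j≤i)

module _ (M : ℕ) .{{_ : NonZero M}} where

  gcd∣⇒multiple : ∀ x y → gcd x M ∣ y → ∃[ K ] (K * x) % M ≡ y % M
  gcd∣⇒multiple x y (divides c refl) with Bézout.identity (gcd-GCD x M)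
  ... | Bézout.+- a b g+bM≡ax = c * a , (begin
    (c * a * x) % M                   ≡⟨ cong (_% M) (*-assoc c a x) ⟩
    (c * (a * x)) % M                 ≡⟨ cong (λ t → (c * t) % M) g+bM≡ax ⟨
    (c * (g + b * M)) % M             ≡⟨ cong (_% M) (distrib c g b M) ⟩
    (c * g + c * b * M) % M           ≡⟨ [m+kn]%n≡m%n (c * g) (c * b) M ⟩
    (c * g) % M                       ∎)
    where
    open ≡-Reasoning
    g : ℕ
    g = gcd x M
    distrib : ∀ c g b M → c * (g + b * M) ≡ c * g + c * b * M
    distrib = solve-∀
  ... | Bézout.-+ a b g+ax≡bM = c * a * pred M , (begin
    (c * a * pred M * x) % M                   ≡⟨ [m+kn]%n≡m%n _ (c * b) M ⟨
    (c * a * pred M * x + c * b * M) % M       ≡⟨ cong (_% M) (cong₂ _+_ refl (*-assoc c b M)) ⟩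
    (c * a * pred M * x + c * (b * M)) % M     ≡⟨ cong (λ t → (c * a * pred M * x + c * t) % M) g+ax≡bM ⟨
    (c * a * pred M * x + c * (g + a * x)) % M ≡⟨ cong (_% M) (regroup c a (pred M) x g) ⟩
    (c * g + c * a * x * suc (pred M)) % M     ≡⟨ cong (λ t → (c * g + c * a * x * t) % M) (suc-pred M) ⟩
    (c * g + c * a * x * M) % M                ≡⟨ [m+kn]%n≡m%n (c * g) (c * a * x) M ⟩
    (c * g) % M                                ∎)
    where
    open ≡-Reasoning
    g : ℕ
    g = gcd x M
    regroup : ∀ c a p x g → c * a * p * x + c * (g + a * x) ≡ c * g + c * a * x * suc p
    regroup = solve-∀

multiple-or-multiple : ∀ n x y →
  let instance _ = m^n≢0 2 n in
  (∃[ K ] (K * x) % 2 ^ n ≡ y % 2 ^ n) ⊎ (∃[ K ] (K * y) % 2 ^ n ≡ x % 2 ^ n)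
multiple-or-multiple n x y with ∣2^n-total n (gcd[m,n]∣n x (2 ^ n)) (gcd[m,n]∣n y (2 ^ n))
... | inj₁ gx∣gy =
  inj₁ (gcd∣⇒multiple (2 ^ n) {{m^n≢0 2 n}} x y (∣-trans gx∣gy (gcd[m,n]∣m y (2 ^ n))))
... | inj₂ gy∣gx =
  inj₂ (gcd∣⇒multiple (2 ^ n) {{m^n≢0 2 n}} y x (∣-trans gy∣gx (gcd[m,n]∣m x (2 ^ n))))

injective⇒≤ℕ : ∀ {N M} (f : ℕ → ℕ) → (∀ {i} → i < N → f i < M) →
  (∀ {i j} → i < N → j < N → f i ≡ f j → i ≡ j) → N ≤ M
injective⇒≤ℕ {N} {M} f f< f-inj = injective⇒≤ {f = f′} λ {i} {j} eq →
  toℕ-injective (f-inj (toℕ<n i) (toℕ<n j) (begin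
    f (toℕ i)        ≡⟨ toℕ-fromℕ< (f< (toℕ<n i)) ⟨
    toℕ (f′ i)       ≡⟨ cong toℕ eq ⟩
    toℕ (f′ j)       ≡⟨ toℕ-fromℕ< (f< (toℕ<n j)) ⟩
    f (toℕ j)        ∎))
  where
  open ≡-Reasoning
  f′ : Fin N → Fin M
  f′ i = fromℕ< (f< (toℕ<n i))

module _ (E : ℕ → ℕ → Set) (V : ℕ) where

  record ℕPath (u v L : ℕ) : Set where
    field
      vertex    : ℕ → ℕ
      vertex<   : ∀ {i} → i ≤ L → vertex i < V
      start     : vertex 0 ≡ u
      end       : vertex L ≡ v
      injective : ∀ {i j} → i ≤ L → j ≤ L → vertex i ≡ vertex j → i ≡ j
      adjacent  : ∀ {i} → i < L → E (vertex i) (vertex (suc i))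

  IsLongest : ℕ → ℕ → ℕ → Set
  IsLongest u v d = ℕPath u v d × (∀ {L} → ℕPath u v L → L ≤ d)

module _ {E : ℕ → ℕ → Set} {V : ℕ} where

  open ℕPath

  trivialPath : ∀ {u} → u < V → ℕPath E V u u 0
  trivialPath {u} u<V = record
    { vertex = λ _ → u ; vertex< = λ _ → u<V ; start = refl ; end = refl
    ; injective = λ { z≤n z≤n _ → refl } ; adjacent = λ () }

  loop-length≡0 : ∀ {u L} → ℕPath E V u u L → L ≡ 0
  loop-length≡0 p = sym (injective p z≤n ≤-refl (trans (start p) (sym (end p))))

  end< : ∀ {u v L} → ℕPath E V u v L → v < V
  end< p = subst (_< V) (end p) (vertex< p ≤-refl)

  reverse : Symmetric E → ∀ {u v L} → ℕPath E V u v L → ℕPath E V v u L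
  reverse E-sym {L = L} p = record
    { vertex    = λ i → vertex p (L ∸ i)
    ; vertex<   = λ {i} _ → vertex< p (m∸n≤m L i)
    ; start     = end p
    ; end       = trans (cong (vertex p) (n∸n≡0 L)) (start p)
    ; injective = λ {i} {j} i≤L j≤L eq →
                    ∸-cancelˡ-≡ i≤L j≤L (injective p (m∸n≤m L i) (m∸n≤m L j) eq)
    ; adjacent  = λ {i} i<L → subst (λ t → E (vertex p t) (vertex p (L ∸ suc i)))
                    (sym (+-∸-assoc 1 i<L)) (E-sym (adjacent p (∸-monoʳ-< z<s i<L)))
    }

  prepend : ∀ {h u v L} (p : ℕPath E V u v L) → h < V → E h u →
            (∀ {i} → i ≤ L → vertex p i ≢ h) → ℕPath E V h v (suc L)
  prepend {h} {L = L} p h<V hEu fresh = record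
    { vertex = vertex′ ; vertex< = vertex′< ; start = refl ; end = end p
    ; injective = injective′ ; adjacent = adjacent′ }
    where
    vertex′ : ℕ → ℕ
    vertex′ zero    = h
    vertex′ (suc i) = vertex p i
    vertex′< : ∀ {i} → i ≤ suc L → vertex′ i < V
    vertex′< {zero}  _       = h<V
    vertex′< {suc i} (s≤s i≤L) = vertex< p i≤L
    injective′ : ∀ {i j} → i ≤ suc L → j ≤ suc L → vertex′ i ≡ vertex′ j → i ≡ j
    injective′ {zero}  {zero}  _         _         _  = refl
    injective′ {zero}  {suc j} _         (s≤s j≤L) eq = contradiction (sym eq) (fresh j≤L)
    injective′ {suc i} {zero}  (s≤s i≤L) _         eq = contradiction eq (fresh i≤L)
    injective′ {suc i} {suc j} (s≤s i≤L) (s≤s j≤L) eq = cong suc (injective p i≤L j≤L eq)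
    adjacent′ : ∀ {i} → i < suc L → E (vertex′ i) (vertex′ (suc i))
    adjacent′ {zero}  _         = subst (E h) (sym (start p)) hEu
    adjacent′ {suc i} (s≤s i<L) = adjacent p i<L

  IsLongest-sym : Symmetric E → ∀ {u v d} → IsLongest E V u v d → IsLongest E V v u d
  IsLongest-sym E-sym (p , maximal) = reverse E-sym p , λ q → maximal (reverse E-sym q)

swap : ℕ → ℕ → ℕ → ℕ
swap a b x with x ≟ a
... | yes _ = b
... | no _ with x ≟ b
...   | yes _ = a
...   | no _  = x

swap-≡ˡ : ∀ a b → swap a b a ≡ b
swap-≡ˡ a b with a ≟ a
... | yes _  = refl
... | no a≢a = contradiction refl a≢a

swap-≡ʳ : ∀ a b → swap a b b ≡ a
swap-≡ʳ a b with b ≟ a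
... | yes b≡a = b≡a
... | no _ with b ≟ b
...   | yes _  = refl
...   | no b≢b = contradiction refl b≢b

swap-≢ : ∀ {a b x} → x ≢ a → x ≢ b → swap a b x ≡ x
swap-≢ {a} {b} {x} x≢a x≢b with x ≟ a
... | yes x≡a = contradiction x≡a x≢a
... | no _ with x ≟ b
...   | yes x≡b = contradiction x≡b x≢b
...   | no _    = refl

swap-involutive : ∀ a b x → swap a b (swap a b x) ≡ x
swap-involutive a b x = by-cases (x ≟ a) (x ≟ b)
  where
  by-cases : Dec (x ≡ a) → Dec (x ≡ b) → swap a b (swap a b x) ≡ x
  by-cases (yes refl) _          = trans (cong (swap x b) (swap-≡ˡ x b)) (swap-≡ʳ x b)
  by-cases (no _)     (yes refl) = trans (cong (swap a x) (swap-≡ʳ a x)) (swap-≡ˡ a x)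
  by-cases (no x≢a)   (no x≢b)   = trans (cong (swap a b) (swap-≢ x≢a x≢b)) (swap-≢ x≢a x≢b)

swap-injective : ∀ a b {x y} → swap a b x ≡ swap a b y → x ≡ y
swap-injective a b {x} {y} eq =
  trans (sym (swap-involutive a b x)) (trans (cong (swap a b) eq) (swap-involutive a b y))

swap-< : ∀ {M a b x} → a < M → b < M → x < M → swap a b x < M
swap-< {a = a} {b} {x} a<M b<M x<M with x ≟ a
... | yes _ = b<M
... | no _ with x ≟ b
...   | yes _ = a<M
...   | no _  = x<M

module CliqueWithPendants
  (E : ℕ → ℕ → Set) (m V : ℕ)
  (E-sym : Symmetric E)
  (E-clique : ∀ {x y} → x < m → y < m → x ≢ y → E x y)
  (E-pendant : ∀ {h y} → m ≤ h → h < V → y < V → E h y → y ≡ 0)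
  (E-pendant-hub : ∀ {h} → m ≤ h → h < V → E h 0)
  (1<m : 1 < m) (m≤V : m ≤ V)
  where

  open ℕPath

  private
    Path′ : ℕ → ℕ → ℕ → Set
    Path′ = ℕPath E V

    Longest : ℕ → ℕ → ℕ → Set
    Longest = IsLongest E V

    0<m : 0 < m
    0<m = <-trans z<s 1<m

    m∸1<m : m ∸ 1 < m
    m∸1<m = ∸-monoʳ-< z<s 0<m

    1+[m∸1]≡m : suc (m ∸ 1) ≡ m
    1+[m∸1]≡m = sym (+-∸-assoc 1 0<m)

    <⇒≤m∸1 : ∀ {L} → L < m → L ≤ m ∸ 1
    <⇒≤m∸1 = ∸-monoˡ-≤ 1

  data Kind : ℕ → Set where
    hub     : Kind 0
    clique  : ∀ {x} → 0 < x → x < m → Kind x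
    pendant : ∀ {x} → m ≤ x → Kind x

  kind : ∀ x → Kind x
  kind zero = hub
  kind (suc x) with suc x <? m
  ... | yes 1+x<m = clique z<s 1+x<m
  ... | no  1+x≮m = pendant (≮⇒≥ 1+x≮m)

  -- The order 0, 1, …, m − 1 permuted by two transpositions so that it starts at u and ends at v.
  cliquePath : ∀ {u v} → u < m → v < m → u ≢ v → Path′ u v (m ∸ 1)
  cliquePath {u} {v} u<m v<m u≢v = record
    { vertex = σ ; vertex< = λ i≤ → ≤-trans (σ< (≤-<-trans i≤ m∸1<m)) m≤V
    ; start = σ0≡u ; end = σm∸1≡v ; injective = λ _ _ → σ-injective
    ; adjacent = λ {i} i< → E-clique (σ< (<-trans (n<1+n i) (≤-<-trans i< m∸1<m)))
                   (σ< (≤-<-trans i< m∸1<m)) (λ eq → 1+n≢n (sym (σ-injective eq))) }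
    where
    w : ℕ
    w = swap 0 u v
    σ : ℕ → ℕ
    σ i = swap 0 u (swap (m ∸ 1) w i)
    σ< : ∀ {i} → i < m → σ i < m
    σ< i<m = swap-< 0<m u<m (swap-< m∸1<m (swap-< 0<m u<m v<m) i<m)
    σ-injective : ∀ {i j} → σ i ≡ σ j → i ≡ j
    σ-injective eq = swap-injective (m ∸ 1) w (swap-injective 0 u eq)
    0≢w : 0 ≢ w
    0≢w 0≡w = u≢v (swap-injective 0 u (trans (swap-≡ʳ 0 u) 0≡w))
    σ0≡u : σ 0 ≡ u
    σ0≡u = trans (cong (swap 0 u) (swap-≢ (<⇒≢ (∸-monoˡ-< 1<m ≤-refl)) 0≢w)) (swap-≡ˡ 0 u)
    σm∸1≡v : σ (m ∸ 1) ≡ v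
    σm∸1≡v = trans (cong (swap 0 u) (swap-≡ˡ (m ∸ 1) w)) (swap-involutive 0 u v)

  -- A pendant vertex has the single neighbour 0, so it cannot sit between two distinct vertices
  -- of a path.
  interior-in-clique : ∀ {u v L} (p : Path′ u v L) {i} → 0 < i → i < L → vertex p i < m
  interior-in-clique {L = L} p {suc j} _ 1+j<L with vertex p (suc j) <? m
  ... | yes inside = inside
  ... | no outside = contradiction (injective p j≤L 2+j≤L (trans before≡0 (sym after≡0)))
                       (<⇒≢ (m<n⇒m<1+n (n<1+n j)))
    where
    j<L : j < L
    j<L = <⇒≤ 1+j<L
    j≤L : j ≤ L
    j≤L = <⇒≤ j<L
    2+j≤L : 2 + j ≤ L
    2+j≤L = 1+j<L
    pendant-neighbour≡0 : ∀ {y} → y < V → E (vertex p (suc j)) y → y ≡ 0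
    pendant-neighbour≡0 y<V = E-pendant (≮⇒≥ outside) (vertex< p j<L) y<V
    before≡0 : vertex p j ≡ 0
    before≡0 = pendant-neighbour≡0 (vertex< p j≤L) (E-sym (adjacent p j<L))
    after≡0 : vertex p (2 + j) ≡ 0
    after≡0 = pendant-neighbour≡0 (vertex< p 2+j≤L) (adjacent p 1+j<L)

  tail-in-clique : ∀ {u v L} (p : Path′ u v L) → v < m → ∀ {i} → 0 < i → i ≤ L → vertex p i < m
  tail-in-clique p v<m 0<i i≤L with m≤n⇒m<n∨m≡n i≤L
  ... | inj₁ i<L  = interior-in-clique p 0<i i<L
  ... | inj₂ refl = subst (_< m) (sym (end p)) v<m

  all-in-clique : ∀ {u v L} (p : Path′ u v L) → u < m → v < m → ∀ {i} → i ≤ L → vertex p i < m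
  all-in-clique p u<m v<m {zero}  _   = subst (_< m) (sym (start p)) u<m
  all-in-clique p u<m v<m {suc i} i≤L = tail-in-clique p v<m z<s i≤L

  length≤m-to-clique : ∀ {u v L} → Path′ u v L → v < m → L ≤ m
  length≤m-to-clique p v<m = injective⇒≤ℕ (λ i → vertex p (suc i)) (tail-in-clique p v<m z<s)
    (λ i<L j<L eq → suc-injective (injective p i<L j<L eq))

  length<m-in-clique : ∀ {u v L} → Path′ u v L → u < m → v < m → L < m
  length<m-in-clique p u<m v<m =
    injective⇒≤ℕ (vertex p) (λ i<1+L → all-in-clique p u<m v<m (s≤s⁻¹ i<1+L))
    (λ i<1+L j<1+L → injective p (s≤s⁻¹ i<1+L) (s≤s⁻¹ j<1+L))

  pendant-next≡0 : ∀ {h v L} (p : Path′ h v (suc L)) → m ≤ h → vertex p 1 ≡ 0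
  pendant-next≡0 p m≤h = E-pendant (subst (m ≤_) (sym (start p)) m≤h) (vertex< p z≤n)
    (vertex< p (s≤s z≤n)) (adjacent p z<s)

  length-pendant-hub : ∀ {h L} → Path′ h 0 L → m ≤ h → L ≤ 1
  length-pendant-hub {L = zero}  p m≤h = z≤n
  length-pendant-hub {L = suc L} p m≤h =
    ≤-reflexive (sym (injective p (s≤s z≤n) ≤-refl (trans (pendant-next≡0 p m≤h) (sym (end p)))))

  length-pendant-pendant : ∀ {h h′ L} → Path′ h h′ L → m ≤ h → m ≤ h′ → h ≢ h′ → L ≤ 2
  length-pendant-pendant {L = zero} p _ _ h≢h′ =
    contradiction (trans (sym (start p)) (end p)) h≢h′
  length-pendant-pendant {L = suc zero} p m≤h m≤h′ _ =
    contradiction (trans (sym (end p)) (pendant-next≡0 p m≤h)) (>⇒≢ (<-≤-trans 0<m m≤h′))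
  length-pendant-pendant {L = suc (suc L)} p m≤h m≤h′ _ =
    s≤s (s≤s (≤-reflexive (suc-injective (sym (injective p (s≤s z≤n) (n≤1+n _) both-next-to-0)))))
    where
    -- the step before the end is the first step of the reversed path
    both-next-to-0 : vertex p 1 ≡ vertex p (suc L)
    both-next-to-0 = trans (pendant-next≡0 p m≤h) (sym (pendant-next≡0 (reverse E-sym p) m≤h′))

  pendantHubPath : ∀ {h} → m ≤ h → h < V → Path′ h 0 1
  pendantHubPath m≤h h<V = prepend (trivialPath (≤-trans 0<m m≤V)) h<V (E-pendant-hub m≤h h<V)
    λ { z≤n 0≡h → <⇒≢ (<-≤-trans 0<m m≤h) 0≡h }

  pendantPendantPath : ∀ {h h′} → m ≤ h → h < V → m ≤ h′ → h′ < V → h ≢ h′ → Path′ h h′ 2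
  pendantPendantPath {h} m≤h h<V m≤h′ h′<V h≢h′ =
    prepend (reverse E-sym (pendantHubPath m≤h′ h′<V)) h<V (E-pendant-hub m≤h h<V) fresh
    where
    fresh : ∀ {i} → i ≤ 1 → vertex (reverse E-sym (pendantHubPath m≤h′ h′<V)) i ≢ h
    fresh z≤n       0≡h  = <⇒≢ (<-≤-trans 0<m m≤h) 0≡h
    fresh (s≤s z≤n) h′≡h = h≢h′ (sym h′≡h)

  pendantCliquePath : ∀ {h x} → m ≤ h → h < V → 0 < x → x < m → Path′ h x m
  pendantCliquePath {h} {x} m≤h h<V 0<x x<m = subst (Path′ h x) 1+[m∸1]≡m
    (prepend through-clique h<V (E-pendant-hub m≤h h<V)
      λ i≤ vᵢ≡h → <⇒≱ (all-in-clique through-clique 0<m x<m i≤) (subst (m ≤_) (sym vᵢ≡h) m≤h))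
    where
    through-clique : Path′ 0 x (m ∸ 1)
    through-clique = cliquePath 0<m x<m (<⇒≢ 0<x)

  longest-loop : ∀ {u} → u < V → Longest u u 0
  longest-loop u<V = trivialPath u<V , λ p → ≤-reflexive (loop-length≡0 p)

  longest-clique : ∀ {u v} → u < m → v < m → u ≢ v → Longest u v (m ∸ 1)
  longest-clique u<m v<m u≢v =
    cliquePath u<m v<m u≢v , λ p → <⇒≤m∸1 (length<m-in-clique p u<m v<m)

  longest-pendant-clique : ∀ {h x} → m ≤ h → h < V → 0 < x → x < m → Longest h x m
  longest-pendant-clique m≤h h<V 0<x x<m =
    pendantCliquePath m≤h h<V 0<x x<m , λ p → length≤m-to-clique p x<m

  longest-pendant-hub : ∀ {h} → m ≤ h → h < V → Longest h 0 1
  longest-pendant-hub m≤h h<V = pendantHubPath m≤h h<V , λ p → length-pendant-hub p m≤h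

  longest-pendant-pendant : ∀ {h h′} → m ≤ h → h < V → m ≤ h′ → h′ < V → h ≢ h′ → Longest h h′ 2
  longest-pendant-pendant m≤h h<V m≤h′ h′<V h≢h′ =
    pendantPendantPath m≤h h<V m≤h′ h′<V h≢h′ , λ p → length-pendant-pendant p m≤h m≤h′ h≢h′

  longest-clique-pendant : ∀ {x h} → 0 < x → x < m → m ≤ h → h < V → Longest x h m
  longest-clique-pendant 0<x x<m m≤h h<V =
    IsLongest-sym E-sym (longest-pendant-clique m≤h h<V 0<x x<m)

  longest-hub-pendant : ∀ {h} → m ≤ h → h < V → Longest 0 h 1
  longest-hub-pendant m≤h h<V = IsLongest-sym E-sym (longest-pendant-hub m≤h h<V)

  length≤m : ∀ {u v L} → Path′ u v L → L ≤ m
  length≤m {u} {v} p with kind u | kind v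
  ... | _          | hub          = length≤m-to-clique p 0<m
  ... | _          | clique _ v<m = length≤m-to-clique p v<m
  ... | hub        | pendant _    = length≤m-to-clique (reverse E-sym p) 0<m
  ... | clique _ u<m | pendant _  = length≤m-to-clique (reverse E-sym p) u<m
  ... | pendant m≤u | pendant m≤v with u ≟ v
  ...   | yes refl = ≤-trans (≤-reflexive (loop-length≡0 p)) z≤n
  ...   | no u≢v   = ≤-trans (length-pendant-pendant p m≤u m≤v u≢v) 1<m

  path-of-length≥m∸1 : ∀ {u} → u < V → ∃[ v ] ∃[ L ] m ∸ 1 ≤ L × Path′ u v L
  path-of-length≥m∸1 {u} u<V with kind u
  ... | hub          = 1 , m ∸ 1 , ≤-refl , cliquePath 0<m 1<m (λ ())
  ... | clique 0<u u<m = 0 , m ∸ 1 , ≤-refl , cliquePath u<m 0<m (>⇒≢ 0<u)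
  ... | pendant m≤u  = 1 , m , m∸n≤m m 1 , pendantCliquePath m≤u u<V z<s 1<m

module _ {n u v L : ℕ} where

  toPath : ℕPath (Adj n) (2 ^ n) u v L → Path n u v L
  toPath p = record
    { vert     = λ i → vertex (toℕ i)
    ; inG      = λ i → vertex< (s≤s⁻¹ (toℕ<n i))
    ; start    = start
    ; end      = trans (cong vertex (toℕ-fromℕ L)) end
    ; distinct = λ {i} {j} eq →
                   toℕ-injective (injective (s≤s⁻¹ (toℕ<n i)) (s≤s⁻¹ (toℕ<n j)) eq)
    ; adjacent = λ i → subst (λ t → Adj n (vertex t) (vertex (suc (toℕ i))))
                           (sym (toℕ-inject₁ i)) (adjacent (toℕ<n i))
    }
    where open ℕPath p

  -- Indices beyond L are sent to the junk vertex 0.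
  fromPath : Path n u v L → ℕPath (Adj n) (2 ^ n) u v L
  fromPath p = record
    { vertex    = vertex
    ; vertex<   = λ i≤L → subst (_< 2 ^ n) (sym (vertex-index i≤L)) (inG _)
    ; start     = trans (vertex-toℕ fzero) start
    ; end       = trans (cong vertex (sym (toℕ-fromℕ L))) (trans (vertex-toℕ (fromℕ L)) end)
    ; injective = injective′
    ; adjacent  = adjacent′
    }
    where
    open Path p
    open ≡-Reasoning
    vertex : ℕ → ℕ
    vertex i with i <? suc L
    ... | yes i<1+L = vert (fromℕ< i<1+L)
    ... | no _      = 0
    vertex-toℕ : ∀ i → vertex (toℕ i) ≡ vert i
    vertex-toℕ i with toℕ i <? suc L
    ... | yes i<1+L = cong vert (fromℕ<-toℕ i i<1+L)
    ... | no  i≮1+L = contradiction (toℕ<n i) i≮1+L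
    index : ∀ {i} → i ≤ L → Fin (suc L)
    index i≤L = fromℕ< (s≤s i≤L)
    vertex-index : ∀ {i} (i≤L : i ≤ L) → vertex i ≡ vert (index i≤L)
    vertex-index i≤L = trans (cong vertex (sym (toℕ-fromℕ< (s≤s i≤L)))) (vertex-toℕ _)
    injective′ : ∀ {i j} → i ≤ L → j ≤ L → vertex i ≡ vertex j → i ≡ j
    injective′ {i} {j} i≤L j≤L eq = begin
      i                ≡⟨ toℕ-fromℕ< (s≤s i≤L) ⟨
      toℕ (index i≤L)  ≡⟨ cong toℕ (distinct vertex-indices≡) ⟩
      toℕ (index j≤L)  ≡⟨ toℕ-fromℕ< (s≤s j≤L) ⟩
      j                ∎
      where
      vertex-indices≡ : vert (index i≤L) ≡ vert (index j≤L)
      vertex-indices≡ = trans (sym (vertex-index i≤L)) (trans eq (vertex-index j≤L))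
    adjacent′ : ∀ {i} → i < L → Adj n (vertex i) (vertex (suc i))
    adjacent′ {i} i<L = subst₂ (Adj n)
      (trans (sym (vertex-toℕ (inject₁ i′))) (cong vertex (trans (toℕ-inject₁ i′) (toℕ-fromℕ< i<L))))
      (trans (sym (vertex-toℕ (fsuc i′))) (cong (λ t → vertex (suc t)) (toℕ-fromℕ< i<L)))
      (adjacent i′)
      where
      i′ : Fin L
      i′ = fromℕ< i<L

longest⇒detour : ∀ {n u v d} → IsLongest (Adj n) (2 ^ n) u v d → IsDetourDist n u v d
longest⇒detour (p , maximal) = toPath p , λ _ q → maximal (fromPath q)

longest⇒detourEcc : ∀ {n u e} →
  (∀ v → v < 2 ^ n → ∃[ d ] IsLongest (Adj n) (2 ^ n) u v d × d ≤ e) →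
  (∃[ v ] v < 2 ^ n × IsLongest (Adj n) (2 ^ n) u v e) → IsDetourEcc n u e
longest⇒detourEcc bounded (v , v<2^n , longest) =
  (λ w w<2^n → let d , longest-uw , d≤e = bounded w w<2^n in d , longest⇒detour longest-uw , d≤e) ,
  v , v<2^n , longest⇒detour longest

module PowerGraph (k : ℕ) where

  private
    n m q : ℕ
    n = 2 + k
    m = half n
    q = quarter n

    0<m : 0 < m
    0<m = m^n>0 2 (suc k)

    1<m : 1 < m
    1<m = ^-monoʳ-< 2 (s≤s (s≤s z≤n)) {0} {suc k} z<s

    m<2^n : m < 2 ^ n
    m<2^n = subst (m <_) (cong (m +_) (sym (+-identityʳ m))) (m<m+n m 0<m)

    instance
      m≢0 : NonZero m
      m≢0 = m^n≢0 2 (suc k)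

  op-P-P : ∀ {i j} → i < m → j < m → op n i j ≡ (i + j) % m
  op-P-P {i} {j} i<m j<m with i <? m | j <? m
  ... | yes _   | yes _   = refl
  ... | no i≮m  | _       = contradiction i<m i≮m
  ... | yes _   | no j≮m  = contradiction j<m j≮m

  op-H-P : ∀ {h j} → m ≤ h → j < m → op n h j ≡ (h + (q ∸ 1) * j) % m + m
  op-H-P {h} {j} m≤h j<m with h <? m | j <? m
  ... | no _    | yes _   = refl
  ... | yes h<m | _       = contradiction m≤h (<⇒≱ h<m)
  ... | no _    | no j≮m  = contradiction j<m j≮m

  op-H-H : ∀ {h h′} → m ≤ h → m ≤ h′ → op n h h′ ≡ ((q + 1) * h + (q ∸ 1) * h′) % m
  op-H-H {h} {h′} m≤h m≤h′ with h <? m | h′ <? m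
  ... | no _    | no _     = refl
  ... | yes h<m | _        = contradiction m≤h (<⇒≱ h<m)
  ... | no _    | yes h′<m = contradiction m≤h′ (<⇒≱ h′<m)

  pow-P : ∀ {a} → a < m → ∀ j → pow n a j ≡ (suc j * a) % m
  pow-P {a} a<m zero = begin
    a                 ≡⟨ m<n⇒m%n≡m a<m ⟨
    a % m             ≡⟨ cong (_% m) (+-identityʳ a) ⟨
    (a + 0) % m       ∎
    where open ≡-Reasoning
  pow-P {a} a<m (suc j) = begin
    op n a (pow n a j)             ≡⟨ op-P-P a<m (subst (_< m) (sym (pow-P a<m j)) (m%n<n _ m)) ⟩
    (a + pow n a j) % m            ≡⟨ cong (λ t → (a + t) % m) (pow-P a<m j) ⟩
    (a + b % m) % m                ≡⟨ [m+kn]%n≡m%n (a + b % m) (b / m) m ⟨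
    (a + b % m + b / m * m) % m    ≡⟨ cong (_% m) (+-assoc a (b % m) (b / m * m)) ⟩
    (a + (b % m + b / m * m)) % m  ≡⟨ cong (λ t → (a + t) % m) (m≡m%n+[m/n]*n b m) ⟨
    (a + b) % m                    ∎
    where
    open ≡-Reasoning
    b = suc j * a

  pow-P< : ∀ {a} → a < m → ∀ j → pow n a j < m
  pow-P< a<m j = subst (_< m) (sym (pow-P a<m j)) (m%n<n _ m)

  pow-P-multiple : ∀ {a} → a < m → ∀ K → pow n a (K + pred m) ≡ (K * a) % m
  pow-P-multiple {a} a<m K = begin
    pow n a (K + pred m)           ≡⟨ pow-P a<m (K + pred m) ⟩
    (suc (K + pred m) * a) % m     ≡⟨ cong (λ t → (t * a) % m) (+-suc K (pred m)) ⟨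
    ((K + suc (pred m)) * a) % m   ≡⟨ cong (λ t → ((K + t) * a) % m) (suc-pred m) ⟩
    ((K + m) * a) % m              ≡⟨ cong (_% m) (*-distribʳ-+ a K m) ⟩
    (K * a + m * a) % m            ≡⟨ cong (λ t → (K * a + t) % m) (*-comm m a) ⟩
    (K * a + a * m) % m            ≡⟨ [m+kn]%n≡m%n (K * a) a m ⟩
    (K * a) % m                    ∎
    where open ≡-Reasoning

  op-H-self : ∀ {h} → m ≤ h → op n h h ≡ 0
  op-H-self {h} m≤h = begin
    op n h h                               ≡⟨ op-H-H m≤h m≤h ⟩
    ((q + 1) * h + (q ∸ 1) * h) % m        ≡⟨ cong (_% m) (*-distribʳ-+ h (q + 1) (q ∸ 1)) ⟨
    ((q + 1 + (q ∸ 1)) * h) % m            ≡⟨ cong (λ t → (t * h) % m) q+1+[q∸1]≡m ⟩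
    (m * h) % m                            ≡⟨ cong (_% m) (*-comm m h) ⟩
    (h * m) % m                            ≡⟨ m*n%n≡0 h m ⟩
    0                                      ∎
    where
    open ≡-Reasoning
    q+1+[q∸1]≡m : q + 1 + (q ∸ 1) ≡ m
    q+1+[q∸1]≡m = begin
      q + 1 + (q ∸ 1)   ≡⟨ +-assoc q 1 (q ∸ 1) ⟩
      q + suc (q ∸ 1)   ≡⟨ cong (q +_) (suc-pred q {{m^n≢0 2 k}}) ⟩
      q + q             ≡⟨ cong (q +_) (+-identityʳ q) ⟨
      m                 ∎

  op-H-0 : ∀ {h} → m ≤ h → h < 2 ^ n → op n h 0 ≡ h
  op-H-0 {h} m≤h h<2^n = begin
    op n h 0                      ≡⟨ op-H-P m≤h 0<m ⟩
    (h + (q ∸ 1) * 0) % m + m     ≡⟨ cong (λ t → (h + t) % m + m) (*-zeroʳ (q ∸ 1)) ⟩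
    (h + 0) % m + m               ≡⟨ cong (λ t → t % m + m) (+-identityʳ h) ⟩
    h % m + m                     ≡⟨ cong (_+ m) (m≤n⇒[n∸m]%m≡n%m m≤h) ⟨
    (h ∸ m) % m + m               ≡⟨ cong (_+ m) (m<n⇒m%n≡m h∸m<m) ⟩
    h ∸ m + m                     ≡⟨ m∸n+n≡m m≤h ⟩
    h                             ∎
    where
    open ≡-Reasoning
    h∸m<m : h ∸ m < m
    h∸m<m = m<n+o⇒m∸n<o h m (subst (h <_) (cong (m +_) (+-identityʳ m)) h<2^n)

  pow-H : ∀ {h} → m ≤ h → h < 2 ^ n → ∀ j → pow n h j ≡ h ⊎ pow n h j ≡ 0
  pow-H m≤h h<2^n zero = inj₁ refl
  pow-H {h} m≤h h<2^n (suc j) with pow-H m≤h h<2^n j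
  ... | inj₁ hʲ≡h = inj₂ (trans (cong (op n h) hʲ≡h) (op-H-self m≤h))
  ... | inj₂ hʲ≡0 = inj₁ (trans (cong (op n h) hʲ≡0) (op-H-0 m≤h h<2^n))

  Adj-sym : ∀ {x y} → Adj n x y → Adj n y x
  Adj-sym (x≢y , j , inj₁ xʲ≡y) = (λ y≡x → x≢y (sym y≡x)) , j , inj₂ xʲ≡y
  Adj-sym (x≢y , j , inj₂ yʲ≡x) = (λ y≡x → x≢y (sym y≡x)) , j , inj₁ yʲ≡x

  Adj-P : ∀ {x y} → x < m → y < m → x ≢ y → Adj n x y
  Adj-P {x} {y} x<m y<m x≢y with multiple-or-multiple (suc k) x y
  ... | inj₁ (K , Kx≡y) = x≢y , K + pred m ,
          inj₁ (trans (pow-P-multiple x<m K) (trans Kx≡y (m<n⇒m%n≡m y<m)))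
  ... | inj₂ (K , Ky≡x) = x≢y , K + pred m ,
          inj₂ (trans (pow-P-multiple y<m K) (trans Ky≡x (m<n⇒m%n≡m x<m)))

  Adj-H⇒≡0 : ∀ {h y} → m ≤ h → h < 2 ^ n → y < 2 ^ n → Adj n h y → y ≡ 0
  Adj-H⇒≡0 m≤h h<2^n _ (h≢y , j , inj₁ hʲ≡y) with pow-H m≤h h<2^n j
  ... | inj₁ hʲ≡h = contradiction (trans (sym hʲ≡h) hʲ≡y) h≢y
  ... | inj₂ hʲ≡0 = trans (sym hʲ≡y) hʲ≡0
  Adj-H⇒≡0 {y = y} m≤h h<2^n y<2^n (h≢y , j , inj₂ yʲ≡h) with y <? m
  ... | yes y<m = contradiction (subst (_< m) yʲ≡h (pow-P< y<m j)) (≤⇒≯ m≤h)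
  ... | no y≮m with pow-H (≮⇒≥ y≮m) y<2^n j
  ...   | inj₁ yʲ≡y = contradiction (trans (sym yʲ≡h) yʲ≡y) h≢y
  ...   | inj₂ yʲ≡0 = contradiction (trans (sym yʲ≡h) yʲ≡0) (>⇒≢ (<-≤-trans 0<m m≤h))

  Adj-H-0 : ∀ {h} → m ≤ h → h < 2 ^ n → Adj n h 0
  Adj-H-0 m≤h _ = (>⇒≢ (<-≤-trans 0<m m≤h)) , 1 , inj₁ (op-H-self m≤h)

  open CliqueWithPendants (Adj n) m (2 ^ n) Adj-sym Adj-P Adj-H⇒≡0 Adj-H-0 1<m (<⇒≤ m<2^n)

  detourEcc-P : ∀ u → 0 < u → u < m → IsDetourEcc n u m
  detourEcc-P u 0<u u<m =
    longest⇒detourEcc bounded (m , m<2^n , longest-clique-pendant 0<u u<m ≤-refl m<2^n)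
    where
    bounded : ∀ v → v < 2 ^ n → ∃[ d ] IsLongest (Adj n) (2 ^ n) u v d × d ≤ m
    bounded v v<2^n with kind v
    ... | hub         = m ∸ 1 , longest-clique u<m 0<m (>⇒≢ 0<u) , m∸n≤m m 1
    ... | pendant m≤v = m , longest-clique-pendant 0<u u<m m≤v v<2^n , ≤-refl
    ... | clique _ v<m with u ≟ v
    ...   | yes refl = 0 , longest-loop v<2^n , z≤n
    ...   | no u≢v   = m ∸ 1 , longest-clique u<m v<m u≢v , m∸n≤m m 1

  detourEcc-e : IsDetourEcc n 0 (m ∸ 1)
  detourEcc-e = longest⇒detourEcc bounded (1 , <-trans 1<m m<2^n , longest-clique 0<m 1<m (λ ()))
    where
    bounded : ∀ v → v < 2 ^ n → ∃[ d ] IsLongest (Adj n) (2 ^ n) 0 v d × d ≤ m ∸ 1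
    bounded v v<2^n with kind v
    ... | hub            = 0 , longest-loop v<2^n , z≤n
    ... | clique 0<v v<m = m ∸ 1 , longest-clique 0<m v<m (<⇒≢ 0<v) , ≤-refl
    ... | pendant m≤v    = 1 , longest-hub-pendant m≤v v<2^n , ∸-monoˡ-≤ 1 1<m

  detourEcc-H : ∀ u → m ≤ u → u < 2 ^ n → IsDetourEcc n u m
  detourEcc-H u m≤u u<2^n =
    longest⇒detourEcc bounded (1 , <-trans 1<m m<2^n , longest-pendant-clique m≤u u<2^n z<s 1<m)
    where
    bounded : ∀ v → v < 2 ^ n → ∃[ d ] IsLongest (Adj n) (2 ^ n) u v d × d ≤ m
    bounded v v<2^n with kind v
    ... | hub            = 1 , longest-pendant-hub m≤u u<2^n , <⇒≤ 1<m
    ... | clique 0<v v<m = m , longest-pendant-clique m≤u u<2^n 0<v v<m , ≤-refl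
    ... | pendant m≤v with u ≟ v
    ...   | yes refl = 0 , longest-loop v<2^n , z≤n
    ...   | no u≢v   = 2 , longest-pendant-pendant m≤u u<2^n m≤v v<2^n u≢v , 1<m

  detourRadius : IsDetourRadius n (m ∸ 1)
  detourRadius = (0 , <-trans 0<m m<2^n , detourEcc-e) , minimal
    where
    minimal : ∀ u e → InG n u → IsDetourEcc n u e → m ∸ 1 ≤ e
    minimal u e u<2^n (bounded , _) with path-of-length≥m∸1 u<2^n
    ... | v , L , m∸1≤L , p with bounded v (end< p)
    ...   | d , (_ , maximal) , d≤e = ≤-trans m∸1≤L (≤-trans (maximal L (toPath p)) d≤e)

  detourDiameter : IsDetourDiameter n m
  detourDiameter = (1 , <-trans 1<m m<2^n , detourEcc-P 1 z<s 1<m) , maximal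
    where
    maximal : ∀ u e → InG n u → IsDetourEcc n u e → e ≤ m
    maximal u e _ (_ , v , _ , p , _) = length≤m (fromPath p)

mainTheorem10 : (n : ℕ) → 3 ≤ n →
    ((∀ u → 0 < u → u < half n → IsDetourEcc n u (half n))
      × IsDetourEcc n 0 (half n ∸ 1)
      × (∀ u → half n ≤ u → u < 2 ^ n → IsDetourEcc n u (half n)))
    × IsDetourRadius n (half n ∸ 1)
    × IsDetourDiameter n (half n)
mainTheorem10 (suc (suc (suc k))) _ =
  (detourEcc-P , detourEcc-e , detourEcc-H) , detourRadius , detourDiameter
  where open PowerGraph (suc k)
mainTheorem10 1 (s≤s ())
mainTheorem10 2 (s≤s (s≤s ()))
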